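{- Let $n \ge 9$ be an integer, let $\delta_0 = \frac{1}{400}$, and let $\vec\alpha,\vec\beta \in \mathbb{F}_2^n$ be distinct. Then there exists a reconfiguration sequence $\Pi = (\mathrm{Had}(\vec\alpha),\dots,\mathrm{Had}(\vec\beta))$ of functions $\mathbb{F}_2^n \to \mathbb{F}_2$ from $\mathrm{Had}(\vec\alpha)$ to $\mathrm{Had}(\vec\beta)$ such that for every function $f$ in $\Pi$ and every $\vec\gamma \in \mathbb{F}_2^n \setminus\{\vec\alpha,\vec\beta\}$, $$\min\{\Delta(f,\mathrm{Had}(\vec\alpha)),\Delta(f,\mathrm{Had}(\vec\beta))\} \le \tfrac14 \quad\text{and}\quad \Delta(f,\mathrm{Had}(\vec\gamma)) > \tfrac14 + \delta_0.$$
   Context: For $\vec\alpha \in \mathbb{F}_2^n$, the Hadamard codeword $\mathrm{Had}(\vec\alpha):\mathbb{F}_2^n\to\mathbb{F}_2$ is $\vec x \mapsto \langle \vec\alpha,\vec x\rangle$. For $f,g:\mathbb{F}_2^n\to\mathbb{F}_2$, $\Delta(f,g) = \Pr_{\vec x \sim \mathbb{F}_2^n}[f(\vec x)\neq g(\vec x)]$ is the relative distance. A reconfiguration sequence from $f^{\mathsf{ini}}$ to $f^{\mathsf{tar}}$ is a finite sequence $(f^{(1)},\dots,f^{(T)})$ of functions $\mathbb{F}_2^n\to\mathbb{F}_2$ with $f^{(1)}=f^{\mathsf{ini}}$, $f^{(T)}=f^{\mathsf{tar}}$, and consecutive functions differing on at most one input. -}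

module Defs where

open import Data.Bool using (Bool; true; false; _xor_; _∧_; if_then_else_)
open import Data.Nat using (ℕ; zero; suc; _^_)
open import Data.Nat.Properties using (m^n≢0)
open import Data.Integer using (+_)
open import Data.Rational using (ℚ; _/_)
open import Data.List using (List; []; _∷_; _++_; map; length; filter)
open import Data.Vec using (Vec; []; _∷_; foldr; zipWith)
open import Data.Fin using (Fin; zero; suc; fromℕ; inject₁)
open import Relation.Binary.PropositionalEquality using (_≡_; _≢_)
open import Relation.Nullary using (¬_)
open import Data.Bool.Properties using (_≟_)
open import Data.Product using (∃)

-- 𝔽₂ is modelled by Bool (addition = xor, multiplication = ∧),
-- 𝔽₂ⁿ by Vec Bool n.
𝔽₂ⁿ : ℕ → Set
𝔽₂ⁿ n = Vec Bool n

Fn : ℕ → Set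
Fn n = 𝔽₂ⁿ n → Bool

⟨_,_⟩ : ∀ {n} → 𝔽₂ⁿ n → 𝔽₂ⁿ n → Bool
⟨ a , x ⟩ = foldr (λ _ → Bool) _xor_ false (zipWith _∧_ a x)

Had : ∀ {n} → 𝔽₂ⁿ n → Fn n
Had a x = ⟨ a , x ⟩

allVecs : (n : ℕ) → List (𝔽₂ⁿ n)
allVecs zero = [] ∷ []
allVecs (suc n) = map (false ∷_) (allVecs n) ++ map (true ∷_) (allVecs n)

disagree : ∀ {n} → Fn n → Fn n → ℕ
disagree {n} f g = length (filter (λ x → ¬? (f x ≟ g x)) (allVecs n))
  where open import Relation.Nullary.Decidable using (¬?)

Δ : ∀ {n} → Fn n → Fn n → ℚ
Δ {n} f g = (+ disagree f g) / (2 ^ n)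
  where instance _ = m^n≢0 2 n

DifferAtMostOne : ∀ {n} → Fn n → Fn n → Set
DifferAtMostOne {n} f g = ∃ λ (x : 𝔽₂ⁿ n) → ∀ y → y ≢ x → f y ≡ g y

record ReconfSeq {n : ℕ} (fini ftar : Fn n) : Set where
  field
    T     : ℕ
    seq   : Fin (suc T) → Fn n
    start : ∀ x → seq zero x ≡ fini x
    end   : ∀ x → seq (fromℕ T) x ≡ ftar x
    step  : ∀ (i : Fin T) → DifferAtMostOne (seq (inject₁ i)) (seq (suc i))

-- Pick a coordinate i with αᵢ ≠ βᵢ and three further coordinates j, k, l, and let Q x = xⱼxₖ + xₗ.
-- Walk from Had α to Had β flipping one point at a time, first the points with Q x = 1 and then the
-- others; halfway the walk passes mid = (Had β on Q = 1, Had α on Q = 0). Every f on the walk agrees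
-- with both ends wherever they agree, so its distances to Had α and Had β sum to 1/2; and it lies in
-- the same sense between mid and a codeword c ∈ {α, β} at distance 1/4 from mid. For γ ∉ {α, β} the
-- triangle inequality then gives 2 Δ(f, Had γ) ≥ Δ(Had c, Had γ) + Δ(mid, Had γ) − 1/4
-- = 1/4 + Δ(mid, Had γ).
-- Finally Δ(mid, Had γ) ≥ 5/16: mid differs from Had γ by E = Had (α + γ) plus the indicator of
-- DQ = {⟨α + β, x⟩ = 1, Q x = 1}, of density 1/4. A translation u with E u = 1, ⟨α + β, u⟩ = 0 and
-- Q u = 0 flips E, the set R = {⟨α + β, x⟩ = 1, xⱼ = xₖ = 0, xₗ = 1} of density 1/16 lies in both DQ
-- and its translate, and wherever these two agree, E or its translate disagrees with them.
-- So Δ(f, Had γ) ≥ 9/32 > 1/4 + 1/400.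

module Submission where

open import Defs

module Construction where
  open import Algebra.Bundles using (CommutativeRing)
  open import Data.Bool using (Bool; true; false; _xor_; _∧_; not; if_then_else_; T)
  open import Data.Bool.Properties
    using (xor-comm; xor-same; xor-identityʳ; ∧-zeroʳ; ∧-identityʳ; ∧-distribˡ-xor; ∧-distribʳ-xor; not-distribʳ-xor;
           xor-∧-commutativeRing)
    renaming (_≟_ to _≟ᵇ_)
  open import Data.Nat using (ℕ; zero; suc; _+_; _*_; _^_; _≤_; _<_; z≤n; s≤s; NonZero)
  import Data.Nat.Properties as ℕ
  open import Data.Nat.Tactic.RingSolver using (solve-∀)
  open import Data.Fin using (Fin; zero; suc; toℕ; fromℕ; inject₁; punchIn)
  open import Data.Fin.Properties using (toℕ-fromℕ; toℕ-inject₁; punchInᵢ≢i; punchIn-injective) renaming (_≟_ to _≟ᶠ_)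
  open import Data.List as List using (List; []; _∷_; _++_; _∷ʳ_; take; length; filter)
  open import Data.List.Properties using (filter-++; length-++; take-suc; take-all)
  open import Data.Vec using ([]; _∷_; zipWith; lookup; replicate)
  open import Data.Vec.Properties using (lookup-zipWith) renaming (≡-dec to ≡-dec-Vec)
  open import Data.Integer as ℤ using ()
  import Data.Integer.Properties as ℤ
  open import Data.Rational as ℚ using (_/_; _⊓_) renaming (_≤_ to _≤ℚ_; _<_ to _<ℚ_; _+_ to _+ℚ_)
  import Data.Rational.Properties as ℚ
  import Data.Rational.Unnormalised as ℚᵘ
  import Data.Rational.Unnormalised.Properties as ℚᵘ
  open import Data.Product using (Σ-syntax; ∃; _×_; _,_; proj₂)
  open import Data.Sum as Sum using (_⊎_; inj₁; inj₂)
  open import Function using (_∘_; id; mk⇔)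
  open import Level using (0ℓ)
  open import Relation.Unary using (Pred; Decidable)
  open import Relation.Binary.PropositionalEquality
  open import Relation.Nullary using (yes; no; does; contradiction)
  open import Relation.Nullary.Decidable using (¬?; T?; dec-true; does-⇔)
  open import Data.List.Membership.Propositional using (_∈_)
  open import Data.List.Membership.Propositional.Properties using (∈-++⁺ˡ; ∈-++⁺ʳ; ∈-++⁻; ∈-map⁺; ∈-filter⁺; ∈-filter⁻)
  open import Data.List.Relation.Unary.Any using (here)
  open import Data.List.Relation.Binary.Subset.Propositional using (_⊆_)
  open import Data.List.Relation.Binary.Subset.Propositional.Properties using (∷⁺ʳ)

  open import Algebra.Properties.CommutativeSemigroup
    (CommutativeRing.+-commutativeSemigroup xor-∧-commutativeRing) using () renaming (interchange to xor-interchange)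
  open import Algebra.Properties.CommutativeSemigroup ℕ.+-commutativeSemigroup
    using () renaming (interchange to +-interchange)

  xor-cancel-common : ∀ a b c → (a xor b) xor (a xor c) ≡ b xor c
  xor-cancel-common a b c = trans (xor-interchange a b a c) (cong (_xor (b xor c)) (xor-same a))

  𝟙 : Bool → ℕ
  𝟙 true  = 1
  𝟙 false = 0

  _⊕_ : ∀ {n} → 𝔽₂ⁿ n → 𝔽₂ⁿ n → 𝔽₂ⁿ n
  _⊕_ = zipWith _xor_

  ∑ : ∀ n → (𝔽₂ⁿ n → ℕ) → ℕ
  ∑ zero    f = f []
  ∑ (suc n) f = ∑ n (f ∘ (false ∷_)) + ∑ n (f ∘ (true ∷_))

  ∑-cong : ∀ {n} {f g : 𝔽₂ⁿ n → ℕ} → (∀ x → f x ≡ g x) → ∑ n f ≡ ∑ n g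
  ∑-cong {zero}  f≗g = f≗g []
  ∑-cong {suc n} f≗g = cong₂ _+_ (∑-cong (f≗g ∘ (false ∷_))) (∑-cong (f≗g ∘ (true ∷_)))

  ∑-mono-≤ : ∀ {n} {f g : 𝔽₂ⁿ n → ℕ} → (∀ x → f x ≤ g x) → ∑ n f ≤ ∑ n g
  ∑-mono-≤ {zero}  f≤g = f≤g []
  ∑-mono-≤ {suc n} f≤g = ℕ.+-mono-≤ (∑-mono-≤ (f≤g ∘ (false ∷_))) (∑-mono-≤ (f≤g ∘ (true ∷_)))

  ∑-+ : ∀ {n} (f g : 𝔽₂ⁿ n → ℕ) → ∑ n (λ x → f x + g x) ≡ ∑ n f + ∑ n g
  ∑-+ {zero}  f g = refl
  ∑-+ {suc n} f g = begin
    ∑ n (λ x → f (false ∷ x) + g (false ∷ x)) + ∑ n (λ x → f (true ∷ x) + g (true ∷ x))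
      ≡⟨ cong₂ _+_ (∑-+ (f ∘ (false ∷_)) (g ∘ (false ∷_))) (∑-+ (f ∘ (true ∷_)) (g ∘ (true ∷_))) ⟩
    (∑ n (f ∘ (false ∷_)) + ∑ n (g ∘ (false ∷_))) + (∑ n (f ∘ (true ∷_)) + ∑ n (g ∘ (true ∷_)))
      ≡⟨ +-interchange (∑ n (f ∘ (false ∷_))) _ _ _ ⟩
    ∑ (suc n) f + ∑ (suc n) g ∎
    where open ≡-Reasoning

  ∑-const : ∀ n c → ∑ n (λ _ → c) ≡ 2 ^ n * c
  ∑-const zero    c = sym (ℕ.+-identityʳ c)
  ∑-const (suc n) c = begin
    ∑ n (λ _ → c) + ∑ n (λ _ → c) ≡⟨ cong (λ s → s + s) (∑-const n c) ⟩
    2 ^ n * c + 2 ^ n * c         ≡⟨ cong (2 ^ n * c +_) (ℕ.+-identityʳ _) ⟨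
    2 * (2 ^ n * c)               ≡⟨ ℕ.*-assoc 2 (2 ^ n) c ⟨
    2 ^ suc n * c                 ∎
    where open ≡-Reasoning

  ∑-shift : ∀ {n} (u : 𝔽₂ⁿ n) (f : 𝔽₂ⁿ n → ℕ) → ∑ n (λ x → f (x ⊕ u)) ≡ ∑ n f
  ∑-shift []          f = refl
  ∑-shift (false ∷ u) f = cong₂ _+_ (∑-shift u (f ∘ (false ∷_))) (∑-shift u (f ∘ (true ∷_)))
  ∑-shift {suc n} (true ∷ u) f = trans (cong₂ _+_ (∑-shift u (f ∘ (true ∷_))) (∑-shift u (f ∘ (false ∷_))))
                                (ℕ.+-comm (∑ n (f ∘ (true ∷_))) _)

  count : ∀ {n} → (𝔽₂ⁿ n → Bool) → ℕ
  count {n} P = ∑ n (𝟙 ∘ P)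

  module _ {n : ℕ} where

    count-true : count {n} (λ _ → true) ≡ 2 ^ n
    count-true = trans (∑-const n 1) (ℕ.*-identityʳ (2 ^ n))

    count-mono : ∀ {P Q : 𝔽₂ⁿ n → Bool} → (∀ x → P x ≡ true → Q x ≡ true) → count P ≤ count Q
    count-mono {P} {Q} P⇒Q = ∑-mono-≤ (λ x → 𝟙-mono (P⇒Q x))
      where
      𝟙-mono : ∀ {a b} → (a ≡ true → b ≡ true) → 𝟙 a ≤ 𝟙 b
      𝟙-mono {false} _   = z≤n
      𝟙-mono {true}  a⇒b rewrite a⇒b refl = ℕ.≤-refl

    count-split : ∀ (B P : 𝔽₂ⁿ n → Bool) →
                  count (λ x → B x ∧ P x) + count (λ x → not (B x) ∧ P x) ≡ count P
    count-split B P = trans (sym (∑-+ {n} _ _)) (∑-cong (λ x → 𝟙-split (B x) (P x)))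
      where
      𝟙-split : ∀ b p → 𝟙 (b ∧ p) + 𝟙 (not b ∧ p) ≡ 𝟙 p
      𝟙-split true  p = ℕ.+-identityʳ (𝟙 p)
      𝟙-split false p = refl

    count-halves : ∀ (u : 𝔽₂ⁿ n) (B P : 𝔽₂ⁿ n → Bool) →
                   (∀ x → B (x ⊕ u) ≡ not (B x)) → (∀ x → P (x ⊕ u) ≡ P x) →
                   2 * count (λ x → B x ∧ P x) ≡ count P
    count-halves u B P B-flips P-invariant = begin
      2 * count B∧P                            ≡⟨ cong (count B∧P +_) (ℕ.+-identityʳ _) ⟩
      count B∧P + count B∧P                    ≡⟨ cong (count B∧P +_) (∑-shift u (𝟙 ∘ B∧P)) ⟨
      count B∧P + count (λ x → B∧P (x ⊕ u))    ≡⟨ cong (count B∧P +_) (∑-cong λ x →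
                                                    cong 𝟙 (cong₂ _∧_ (B-flips x) (P-invariant x))) ⟩
      count B∧P + count (λ x → not (B x) ∧ P x) ≡⟨ count-split B P ⟩
      count P                                  ∎
      where
      open ≡-Reasoning
      B∧P : 𝔽₂ⁿ n → Bool
      B∧P x = B x ∧ P x

    count-balanced : ∀ (u : 𝔽₂ⁿ n) (B : 𝔽₂ⁿ n → Bool) →
                     (∀ x → B (x ⊕ u) ≡ not (B x)) → 2 * count B ≡ 2 ^ n
    count-balanced u B B-flips = begin
      2 * count B                        ≡⟨ cong (2 *_) (∑-cong (λ x → cong 𝟙 (∧-identityʳ (B x)))) ⟨
      2 * count (λ x → B x ∧ true)       ≡⟨ count-halves u B (λ _ → true) B-flips (λ _ → refl) ⟩
      count {n} (λ _ → true)             ≡⟨ count-true ⟩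
      2 ^ n                              ∎
      where open ≡-Reasoning

  length-filter-map : ∀ {A B : Set} {P : Pred B 0ℓ} (P? : Decidable P) (f : A → B) (xs : List A) →
                      length (filter P? (List.map f xs)) ≡ length (filter (P? ∘ f) xs)
  length-filter-map P? f []       = refl
  length-filter-map P? f (x ∷ xs) with does (P? (f x))
  ... | true  = cong suc (length-filter-map P? f xs)
  ... | false = length-filter-map P? f xs

  length-filter-allVecs : ∀ n {P : Pred (𝔽₂ⁿ n) 0ℓ} (P? : Decidable P) →
                          length (filter P? (allVecs n)) ≡ count (does ∘ P?)
  length-filter-allVecs zero P? with does (P? [])
  ... | true  = refl
  ... | false = refl
  length-filter-allVecs (suc n) P? = begin
    length (filter P? (evens ++ odds))                ≡⟨ cong length (filter-++ P? evens odds) ⟩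
    length (filter P? evens ++ filter P? odds)        ≡⟨ length-++ (filter P? evens) ⟩
    length (filter P? evens) + length (filter P? odds)
      ≡⟨ cong₂ _+_ (trans (length-filter-map P? (false ∷_) (allVecs n)) (length-filter-allVecs n _))
                   (trans (length-filter-map P? (true ∷_) (allVecs n)) (length-filter-allVecs n _)) ⟩
    count (does ∘ P?)                                 ∎
    where
    open ≡-Reasoning
    evens odds : List (𝔽₂ⁿ (suc n))
    evens = List.map (false ∷_) (allVecs n)
    odds  = List.map (true ∷_) (allVecs n)

  dist : ∀ {n} → Fn n → Fn n → ℕ
  dist f g = count (λ x → f x xor g x)

  disagree≡dist : ∀ {n} (f g : Fn n) → disagree f g ≡ dist f g
  disagree≡dist {n} f g = trans (length-filter-allVecs n _) (∑-cong λ x → cong 𝟙 (does-≢ (f x) (g x)))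
    where
    does-≢ : ∀ a b → does (¬? (a ≟ᵇ b)) ≡ a xor b
    does-≢ true  true  = refl
    does-≢ true  false = refl
    does-≢ false true  = refl
    does-≢ false false = refl

  module _ {n : ℕ} where

    dist-sym : ∀ (f g : Fn n) → dist f g ≡ dist g f
    dist-sym f g = ∑-cong λ x → cong 𝟙 (xor-comm (f x) (g x))

    dist-triangle : ∀ (f g h : Fn n) → dist f h ≤ dist f g + dist g h
    dist-triangle f g h = ℕ.≤-trans (∑-mono-≤ λ x → 𝟙-triangle (f x) (g x) (h x)) (ℕ.≤-reflexive (∑-+ {n} _ _))
      where
      𝟙-triangle : ∀ a b c → 𝟙 (a xor c) ≤ 𝟙 (a xor b) + 𝟙 (b xor c)
      𝟙-triangle true  true  c     = ℕ.≤-refl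
      𝟙-triangle false false c     = ℕ.≤-refl
      𝟙-triangle true  false true  = z≤n
      𝟙-triangle true  false false = ℕ.≤-refl
      𝟙-triangle false true  true  = ℕ.≤-refl
      𝟙-triangle false true  false = z≤n

    Between : Fn n → Fn n → Fn n → Set
    Between g₁ f g₂ = ∀ x → g₁ x ≡ g₂ x → f x ≡ g₁ x

    between-sym : ∀ {g₁ f g₂} → Between g₁ f g₂ → Between g₂ f g₁
    between-sym between x g₂≡g₁ = trans (between x (sym g₂≡g₁)) (sym g₂≡g₁)

    between-respʳ : ∀ {g₁ f g₂ g₂′} → (∀ x → g₂ x ≡ g₂′ x) → Between g₁ f g₂ → Between g₁ f g₂′
    between-respʳ g₂≗g₂′ between x g₁≡g₂′ = between x (trans g₁≡g₂′ (sym (g₂≗g₂′ x)))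

    dist-between : ∀ {g₁ f g₂} → Between g₁ f g₂ → dist g₁ f + dist f g₂ ≡ dist g₁ g₂
    dist-between {g₁} {f} {g₂} between =
      trans (sym (∑-+ {n} _ _)) (∑-cong λ x → 𝟙-between (g₁ x) (f x) (g₂ x) (between x))
      where
      𝟙-between : ∀ a b c → (a ≡ c → b ≡ a) → 𝟙 (a xor b) + 𝟙 (b xor c) ≡ 𝟙 (a xor c)
      𝟙-between true  true  c     _ = refl
      𝟙-between false false c     _ = refl
      𝟙-between true  false false _ = refl
      𝟙-between false true  true  _ = refl
      𝟙-between true  false true  b≡a with () ← b≡a refl
      𝟙-between false true  false b≡a with () ← b≡a refl

    between-lower-bound : ∀ {g₁ f g₂} (k : Fn n) → Between g₁ f g₂ →
                          dist g₁ k + dist g₂ k ≤ dist g₁ g₂ + 2 * dist f k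
    between-lower-bound {g₁} {f} {g₂} k between = begin
      dist g₁ k + dist g₂ k
        ≤⟨ ℕ.+-mono-≤ (dist-triangle g₁ f k) (dist-triangle g₂ f k) ⟩
      (dist g₁ f + dist f k) + (dist g₂ f + dist f k)
        ≡⟨ +-interchange (dist g₁ f) _ _ _ ⟩
      (dist g₁ f + dist g₂ f) + (dist f k + dist f k)
        ≡⟨ cong₂ _+_ (cong (dist g₁ f +_) (dist-sym f g₂)) (cong (dist f k +_) (ℕ.+-identityʳ _)) ⟨
      (dist g₁ f + dist f g₂) + 2 * dist f k
        ≡⟨ cong (_+ 2 * dist f k) (dist-between between) ⟩
      dist g₁ g₂ + 2 * dist f k ∎
      where open ℕ.≤-Reasoning

  𝟎 : ∀ {n} → 𝔽₂ⁿ n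
  𝟎 = replicate _ false

  unit : ∀ {n} → Fin n → 𝔽₂ⁿ n
  unit zero    = true ∷ 𝟎
  unit (suc p) = false ∷ unit p

  lookup-𝟎 : ∀ {n} (p : Fin n) → lookup 𝟎 p ≡ false
  lookup-𝟎 zero    = refl
  lookup-𝟎 (suc p) = lookup-𝟎 p

  lookup-unit : ∀ {n} (p : Fin n) → lookup (unit p) p ≡ true
  lookup-unit zero    = refl
  lookup-unit (suc p) = lookup-unit p

  lookup-unit-≢ : ∀ {n} {p q : Fin n} → p ≢ q → lookup (unit p) q ≡ false
  lookup-unit-≢ {p = zero}  {zero}  p≢q = contradiction refl p≢q
  lookup-unit-≢ {p = zero}  {suc q} p≢q = lookup-𝟎 q
  lookup-unit-≢ {p = suc p} {zero}  p≢q = refl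
  lookup-unit-≢ {p = suc p} {suc q} p≢q = lookup-unit-≢ (p≢q ∘ cong suc)

  lookup-⊕ : ∀ {n} (x y : 𝔽₂ⁿ n) p → lookup (x ⊕ y) p ≡ lookup x p xor lookup y p
  lookup-⊕ x y p = lookup-zipWith _xor_ p x y

  lookup-⊕-unit : ∀ {n} (x : 𝔽₂ⁿ n) p → lookup (x ⊕ unit p) p ≡ not (lookup x p)
  lookup-⊕-unit x p = trans (lookup-⊕ x (unit p) p)
                            (trans (cong (lookup x p xor_) (lookup-unit p)) (xor-comm (lookup x p) true))

  lookup-⊕-unit-≢ : ∀ {n} (x : 𝔽₂ⁿ n) {p q} → p ≢ q → lookup (x ⊕ unit p) q ≡ lookup x q
  lookup-⊕-unit-≢ x {p} {q} p≢q = trans (lookup-⊕ x (unit p) q)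
                                        (trans (cong (lookup x q xor_) (lookup-unit-≢ p≢q)) (xor-identityʳ _))

  Had-𝟎 : ∀ {n} (a : 𝔽₂ⁿ n) → Had a 𝟎 ≡ false
  Had-𝟎 []       = refl
  Had-𝟎 (a ∷ as) = cong₂ _xor_ (∧-zeroʳ a) (Had-𝟎 as)

  Had-unit : ∀ {n} (a : 𝔽₂ⁿ n) p → Had a (unit p) ≡ lookup a p
  Had-unit (a ∷ as) zero    = trans (cong₂ _xor_ (∧-identityʳ a) (Had-𝟎 as)) (xor-identityʳ a)
  Had-unit (a ∷ as) (suc p) = trans (cong (_xor Had as (unit p)) (∧-zeroʳ a)) (Had-unit as p)

  Had-⊕ʳ : ∀ {n} (a x y : 𝔽₂ⁿ n) → Had a (x ⊕ y) ≡ Had a x xor Had a y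
  Had-⊕ʳ []       []       []       = refl
  Had-⊕ʳ (a ∷ as) (x ∷ xs) (y ∷ ys) =
    trans (cong₂ _xor_ (∧-distribˡ-xor a x y) (Had-⊕ʳ as xs ys)) (xor-interchange (a ∧ x) _ _ _)

  Had-⊕ˡ : ∀ {n} (a b x : 𝔽₂ⁿ n) → Had (a ⊕ b) x ≡ Had a x xor Had b x
  Had-⊕ˡ []       []       []       = refl
  Had-⊕ˡ (a ∷ as) (b ∷ bs) (x ∷ xs) =
    trans (cong₂ _xor_ (∧-distribʳ-xor x a b) (Had-⊕ˡ as bs xs)) (xor-interchange (a ∧ x) _ _ _)

  Had-⊕-unit : ∀ {n} (a x : 𝔽₂ⁿ n) p → Had a (x ⊕ unit p) ≡ Had a x xor lookup a p
  Had-⊕-unit a x p = trans (Had-⊕ʳ a x (unit p)) (cong (Had a x xor_) (Had-unit a p))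

  ≢⇒lookup-⊕ : ∀ {n} {a b : 𝔽₂ⁿ n} → a ≢ b → ∃ λ p → lookup (a ⊕ b) p ≡ true
  ≢⇒lookup-⊕ {a = []}     {[]}     a≢b = contradiction refl a≢b
  ≢⇒lookup-⊕ {a = a ∷ as} {b ∷ bs} a≢b with a ≟ᵇ b
  ... | no a≢b₀   = zero , xor-≢ a≢b₀
    where
    xor-≢ : ∀ {a b} → a ≢ b → a xor b ≡ true
    xor-≢ {true}  {true}  a≢b = contradiction refl a≢b
    xor-≢ {true}  {false} _   = refl
    xor-≢ {false} {true}  _   = refl
    xor-≢ {false} {false} a≢b = contradiction refl a≢b
  ... | yes refl with ≢⇒lookup-⊕ (a≢b ∘ cong (a ∷_))
  ...   | p , one = suc p , one

  dist-Had : ∀ {n} {a b : 𝔽₂ⁿ n} → a ≢ b → 2 * dist (Had a) (Had b) ≡ 2 ^ n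
  dist-Had {a = a} {b} a≢b with ≢⇒lookup-⊕ a≢b
  ... | p , one = trans (cong (2 *_) (∑-cong λ x → cong 𝟙 (sym (Had-⊕ˡ a b x))))
                        (count-balanced (unit p) (Had (a ⊕ b)) λ x →
                          trans (Had-⊕-unit (a ⊕ b) x p) (trans (cong (Had (a ⊕ b) x xor_) one) (xor-comm _ true)))

  ∈-allVecs : ∀ {n} (x : 𝔽₂ⁿ n) → x ∈ allVecs n
  ∈-allVecs []          = here refl
  ∈-allVecs (false ∷ x) = ∈-++⁺ˡ (∈-map⁺ (false ∷_) (∈-allVecs x))
  ∈-allVecs (true ∷ x)  = ∈-++⁺ʳ _ (∈-map⁺ (true ∷_) (∈-allVecs x))

  take-++-⊆ : ∀ {A : Set} (xs ys : List A) t → take t (xs ++ ys) ⊆ xs ⊎ xs ⊆ take t (xs ++ ys)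
  take-++-⊆ []       ys t       = inj₂ λ ()
  take-++-⊆ (x ∷ xs) ys zero    = inj₁ λ ()
  take-++-⊆ (x ∷ xs) ys (suc t) = Sum.map (∷⁺ʳ x) (∷⁺ʳ x) (take-++-⊆ xs ys t)

  module Walk {n : ℕ} (g h : Fn n) where

    open import Data.List.Membership.DecPropositional (≡-dec-Vec {n = n} _≟ᵇ_) using (_∈?_)

    flipOn : List (𝔽₂ⁿ n) → Fn n
    flipOn ys x = if does (x ∈? ys) then h x else g x

    flipOn-∈ : ∀ {x ys} → x ∈ ys → flipOn ys x ≡ h x
    flipOn-∈ {x} {ys} x∈ys = cong (if_then h x else g x) (dec-true (x ∈? ys) x∈ys)

    flipOn-between-ends : ∀ ys → Between g (flipOn ys) h
    flipOn-between-ends ys x g≡h with x ∈? ys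
    ... | yes _ = sym g≡h
    ... | no  _ = refl

    flipOn-between-source : ∀ {ys zs} → ys ⊆ zs → Between g (flipOn ys) (flipOn zs)
    flipOn-between-source {ys} ys⊆zs x agree with x ∈? ys
    ... | yes x∈ys = sym (trans agree (flipOn-∈ (ys⊆zs x∈ys)))
    ... | no  _    = refl

    flipOn-between-target : ∀ {xs ys} → xs ⊆ ys → Between (flipOn xs) (flipOn ys) h
    flipOn-between-target {xs} {ys} xs⊆ys x agree with x ∈? xs | x ∈? ys
    ... | yes _    | yes _    = refl
    ... | yes x∈xs | no  x∉ys = contradiction (xs⊆ys x∈xs) x∉ys
    ... | no  _    | no  _    = refl
    ... | no  _    | yes _    = sym agree

    flipOn-filter : ∀ (P : Fn n) x → flipOn (filter (T? ∘ P) (allVecs n)) x ≡ (if P x then h x else g x)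
    flipOn-filter P x = cong (if_then h x else g x)
      (does-⇔ (mk⇔ (proj₂ ∘ ∈-filter⁻ (T? ∘ P) {xs = allVecs n}) (∈-filter⁺ (T? ∘ P) (∈-allVecs x)))
              (x ∈? filter (T? ∘ P) (allVecs n)) (T? (P x)))

    flipOn-∷ʳ : ∀ {y z} ys → y ≢ z → flipOn ys y ≡ flipOn (ys ∷ʳ z) y
    flipOn-∷ʳ {y} {z} ys y≢z =
      cong (if_then h y else g y) (does-⇔ (mk⇔ ∈-++⁺ˡ ∈ys∷ʳz⇒∈ys) (y ∈? ys) (y ∈? (ys ∷ʳ z)))
      where
      ∈ys∷ʳz⇒∈ys : y ∈ ys ∷ʳ z → y ∈ ys
      ∈ys∷ʳz⇒∈ys y∈ = Sum.[ id , (λ { (here y≡z) → contradiction y≡z y≢z }) ] (∈-++⁻ ys y∈)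

    walk : (xs : List (𝔽₂ⁿ n)) → (∀ x → x ∈ xs) → ReconfSeq g h
    walk xs complete = record
      { T     = length xs
      ; seq   = λ t → flipOn (take (toℕ t) xs)
      ; start = λ x → refl
      ; end   = λ x → begin
          flipOn (take (toℕ (fromℕ (length xs))) xs) x ≡⟨ cong (λ m → flipOn (take m xs) x) (toℕ-fromℕ (length xs)) ⟩
          flipOn (take (length xs) xs) x              ≡⟨ cong (λ ys → flipOn ys x) (take-all _ xs ℕ.≤-refl) ⟩
          flipOn xs x                                 ≡⟨ flipOn-∈ (complete x) ⟩
          h x                                         ∎
      ; step  = λ s → List.lookup xs s , λ y y≢ → begin
          flipOn (take (toℕ (inject₁ s)) xs) y            ≡⟨ cong (λ m → flipOn (take m xs) y) (toℕ-inject₁ s) ⟩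
          flipOn (take (toℕ s) xs) y                       ≡⟨ flipOn-∷ʳ (take (toℕ s) xs) y≢ ⟩
          flipOn (take (toℕ s) xs ∷ʳ List.lookup xs s) y   ≡⟨ cong (λ ys → flipOn ys y) (take-suc xs s) ⟨
          flipOn (take (suc (toℕ s)) xs) y                 ∎
      }
      where open ≡-Reasoning

  far-arith : ∀ {M G c s} → M + (s + s) ≤ (G + G) + (c + c) → 4 * c ≡ M → M ≤ 16 * s → 5 * M ≤ 16 * G
  far-arith {M} {G} {c} {s} covering 4c≡M M≤16s = ℕ.+-cancelˡ-≤ (4 * M) (5 * M) (16 * G) (begin
    4 * M + 5 * M                ≡⟨ e₁ M ⟩
    8 * M + M                    ≤⟨ ℕ.+-monoʳ-≤ (8 * M) M≤16s ⟩
    8 * M + 16 * s               ≡⟨ e₂ M s ⟩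
    8 * (M + (s + s))            ≤⟨ ℕ.*-monoʳ-≤ 8 covering ⟩
    8 * ((G + G) + (c + c))      ≡⟨ e₃ G c ⟩
    4 * (4 * c) + 16 * G         ≡⟨ cong (λ m → 4 * m + 16 * G) 4c≡M ⟩
    4 * M + 16 * G               ∎)
    where
    open ℕ.≤-Reasoning
    e₁ : ∀ M → 4 * M + 5 * M ≡ 8 * M + M
    e₁ = solve-∀
    e₂ : ∀ M s → 8 * M + 16 * s ≡ 8 * (M + (s + s))
    e₂ = solve-∀
    e₃ : ∀ G c → 8 * ((G + G) + (c + c)) ≡ 4 * (4 * c) + 16 * G
    e₃ = solve-∀

  between-arith : ∀ {M X a b c} → a + b ≤ c + 2 * X → 2 * a ≡ M → 5 * M ≤ 16 * b → 4 * c ≡ M → 9 * M ≤ 32 * X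
  between-arith {M} {X} {a} {b} {c} lower 2a≡M 5M≤16b 4c≡M = ℕ.+-cancelˡ-≤ (4 * M) (9 * M) (32 * X) (begin
    4 * M + 9 * M                ≡⟨ e₁ M ⟩
    8 * M + 5 * M                ≤⟨ ℕ.+-monoʳ-≤ (8 * M) 5M≤16b ⟩
    8 * M + 16 * b               ≡⟨ cong (λ m → 8 * m + 16 * b) 2a≡M ⟨
    8 * (2 * a) + 16 * b         ≡⟨ e₂ a b ⟩
    16 * (a + b)                 ≤⟨ ℕ.*-monoʳ-≤ 16 lower ⟩
    16 * (c + 2 * X)             ≡⟨ e₃ c X ⟩
    4 * (4 * c) + 32 * X         ≡⟨ cong (λ m → 4 * m + 32 * X) 4c≡M ⟩
    4 * M + 32 * X               ∎)
    where
    open ℕ.≤-Reasoning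
    e₁ : ∀ M → 4 * M + 9 * M ≡ 8 * M + 5 * M
    e₁ = solve-∀
    e₂ : ∀ a b → 8 * (2 * a) + 16 * b ≡ 16 * (a + b)
    e₂ = solve-∀
    e₃ : ∀ c X → 16 * (c + 2 * X) ≡ 4 * (4 * c) + 32 * X
    e₃ = solve-∀

  /-≤-cross : ∀ a b m n .{{_ : NonZero m}} .{{_ : NonZero n}} → a * n ≤ b * m → ℤ.+ a / m ≤ℚ ℤ.+ b / n
  /-≤-cross a b m@(suc m′) n@(suc n′) an≤bm =
    ℚ.toℚᵘ-cancel-≤ (ℚᵘ.≤-respˡ-≃ (ℚᵘ.≃-sym (ℚ.toℚᵘ-fromℚᵘ (ℚᵘ.mkℚᵘ (ℤ.+ a) m′)))
                   (ℚᵘ.≤-respʳ-≃ (ℚᵘ.≃-sym (ℚ.toℚᵘ-fromℚᵘ (ℚᵘ.mkℚᵘ (ℤ.+ b) n′)))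
                     (ℚᵘ.*≤* (subst₂ ℤ._≤_ (ℤ.pos-* a n) (ℤ.pos-* b m) (ℤ.+≤+ an≤bm)))))

  /-<-cross : ∀ a b m n .{{_ : NonZero m}} .{{_ : NonZero n}} → a * n < b * m → ℤ.+ a / m <ℚ ℤ.+ b / n
  /-<-cross a b m@(suc m′) n@(suc n′) an<bm =
    ℚ.toℚᵘ-cancel-< (ℚᵘ.<-respˡ-≃ (ℚᵘ.≃-sym (ℚ.toℚᵘ-fromℚᵘ (ℚᵘ.mkℚᵘ (ℤ.+ a) m′)))
                   (ℚᵘ.<-respʳ-≃ (ℚᵘ.≃-sym (ℚ.toℚᵘ-fromℚᵘ (ℚᵘ.mkℚᵘ (ℤ.+ b) n′)))
                     (ℚᵘ.*<* (subst₂ ℤ._<_ (ℤ.pos-* a n) (ℤ.pos-* b m) (ℤ.+<+ an<bm)))))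

  ratio-near : ∀ a b M .{{_ : NonZero M}} → 2 * (a + b) ≡ M → ((ℤ.+ a / M) ⊓ (ℤ.+ b / M)) ≤ℚ ℤ.+ 1 / 4
  ratio-near a b M 2[a+b]≡M = Sum.[
      (λ a≤b → ℚ.≤-trans (ℚ.p⊓q≤p (ℤ.+ a / M) (ℤ.+ b / M)) (/-≤-cross a 1 M 4 (min-quarter a≤b 2[a+b]≡M))) ,
      (λ b≤a → ℚ.≤-trans (ℚ.p⊓q≤q (ℤ.+ a / M) (ℤ.+ b / M)) (/-≤-cross b 1 M 4 (min-quarter b≤a (trans (cong (2 *_) (ℕ.+-comm b a)) 2[a+b]≡M)))) ]′
    (ℕ.≤-total a b)
    where
    min-quarter : ∀ {x y} → x ≤ y → 2 * (x + y) ≡ M → x * 4 ≤ 1 * M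
    min-quarter {x} {y} x≤y 2[x+y]≡M = begin
      x * 4         ≡⟨ e x ⟩
      2 * (x + x)   ≤⟨ ℕ.*-monoʳ-≤ 2 (ℕ.+-monoʳ-≤ x x≤y) ⟩
      2 * (x + y)   ≡⟨ 2[x+y]≡M ⟩
      M             ≡⟨ ℕ.*-identityˡ M ⟨
      1 * M         ∎
      where
      open ℕ.≤-Reasoning
      e : ∀ x → x * 4 ≡ 2 * (x + x)
      e = solve-∀

  ratio-far : ∀ X M .{{_ : NonZero M}} → 9 * M ≤ 32 * X → (ℤ.+ 1 / 4) +ℚ (ℤ.+ 1 / 400) <ℚ ℤ.+ X / M
  ratio-far X M@(suc _) 9M≤32X = /-<-cross 101 X 400 M (ℕ.*-cancelˡ-< 32 (101 * M) (X * 400) (begin-strict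
    32 * (101 * M)   ≡⟨ ℕ.*-assoc 32 101 M ⟨
    3232 * M         <⟨ ℕ.*-monoˡ-< M (ℕ.≤ᵇ⇒≤ 3233 3600 _) ⟩
    3600 * M         ≡⟨ ℕ.*-assoc 400 9 M ⟩
    400 * (9 * M)    ≤⟨ ℕ.*-monoʳ-≤ 400 9M≤32X ⟩
    400 * (32 * X)   ≡⟨ e X ⟩
    32 * (X * 400)   ∎))
    where
    open ℕ.≤-Reasoning
    e : ∀ X → 400 * (32 * X) ≡ 32 * (X * 400)
    e = solve-∀

  record OtherCoordinates {n : ℕ} (i : Fin n) : Set where
    field
      j k l : Fin n
      i≢j   : i ≢ j
      i≢k   : i ≢ k
      i≢l   : i ≢ l
      j≢k   : j ≢ k
      j≢l   : j ≢ l
      k≢l   : k ≢ l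

  other-coordinates : ∀ {n} → 4 ≤ n → (i : Fin n) → OtherCoordinates i
  other-coordinates (s≤s (s≤s (s≤s (s≤s _)))) i = record
    { j   = punchIn i zero
    ; k   = punchIn i (suc zero)
    ; l   = punchIn i (suc (suc zero))
    ; i≢j = punchInᵢ≢i i zero ∘ sym
    ; i≢k = punchInᵢ≢i i (suc zero) ∘ sym
    ; i≢l = punchInᵢ≢i i (suc (suc zero)) ∘ sym
    ; j≢k = (λ ()) ∘ punchIn-injective i zero (suc zero)
    ; j≢l = (λ ()) ∘ punchIn-injective i zero (suc (suc zero))
    ; k≢l = (λ ()) ∘ punchIn-injective i (suc zero) (suc (suc zero))
    }

  module Path {n : ℕ} (α β : 𝔽₂ⁿ n) {i : Fin n} (others : OtherCoordinates i)
    (dᵢ : lookup (α ⊕ β) i ≡ true) where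

    open OtherCoordinates others

    D : Fn n
    D = Had (α ⊕ β)

    Q : Fn n
    Q x = (lookup x j ∧ lookup x k) xor lookup x l

    mid : Fn n
    mid x = if Q x then Had β x else Had α x

    DQ : Fn n
    DQ x = D x ∧ Q x

    D-flip : ∀ x → D (x ⊕ unit i) ≡ not (D x)
    D-flip x = trans (Had-⊕-unit (α ⊕ β) x i) (trans (cong (D x xor_) dᵢ) (xor-comm (D x) true))

    Q-invariant : ∀ x → Q (x ⊕ unit i) ≡ Q x
    Q-invariant x
      rewrite lookup-⊕-unit-≢ x i≢j | lookup-⊕-unit-≢ x i≢k | lookup-⊕-unit-≢ x i≢l = refl

    Q-flip : ∀ x → Q (x ⊕ unit l) ≡ not (Q x)
    Q-flip x
      rewrite lookup-⊕-unit-≢ x (j≢l ∘ sym) | lookup-⊕-unit-≢ x (k≢l ∘ sym) | lookup-⊕-unit x l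
      = sym (not-distribʳ-xor (lookup x j ∧ lookup x k) (lookup x l))

    quarter : ∀ (P : Fn n) → (∀ x → P (x ⊕ unit l) ≡ not (P x)) → (∀ x → P (x ⊕ unit i) ≡ P x) →
              4 * count (λ x → D x ∧ P x) ≡ 2 ^ n
    quarter P P-flip P-invariant = begin
      4 * count (λ x → D x ∧ P x)       ≡⟨ ℕ.*-assoc 2 2 (count (λ x → D x ∧ P x)) ⟩
      2 * (2 * count (λ x → D x ∧ P x)) ≡⟨ cong (2 *_) (count-halves (unit i) D P D-flip P-invariant) ⟩
      2 * count P                       ≡⟨ count-balanced (unit l) P P-flip ⟩
      2 ^ n                             ∎
      where open ≡-Reasoning

    count-DQ : 4 * count DQ ≡ 2 ^ n
    count-DQ = quarter Q Q-flip Q-invariant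

    dist-α-mid : 4 * dist (Had α) mid ≡ 2 ^ n
    dist-α-mid = trans (cong (4 *_) (∑-cong λ x → cong 𝟙 (begin
        Had α x xor mid x              ≡⟨ xor-if (Q x) (Had α x) (Had β x) ⟩
        (Had α x xor Had β x) ∧ Q x    ≡⟨ cong (_∧ Q x) (Had-⊕ˡ α β x) ⟨
        DQ x                           ∎)))
      count-DQ
      where
      open ≡-Reasoning
      xor-if : ∀ q a b → a xor (if q then b else a) ≡ (a xor b) ∧ q
      xor-if true  a b = sym (∧-identityʳ (a xor b))
      xor-if false a b = trans (xor-same a) (sym (∧-zeroʳ (a xor b)))

    dist-β-mid : 4 * dist (Had β) mid ≡ 2 ^ n
    dist-β-mid = trans (cong (4 *_) (∑-cong λ x → cong 𝟙 (begin
        Had β x xor mid x                ≡⟨ xor-if (Q x) (Had α x) (Had β x) ⟩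
        (Had α x xor Had β x) ∧ not (Q x) ≡⟨ cong (_∧ not (Q x)) (Had-⊕ˡ α β x) ⟨
        D x ∧ not (Q x)                  ∎)))
      (quarter (not ∘ Q) (cong not ∘ Q-flip) (cong not ∘ Q-invariant))
      where
      open ≡-Reasoning
      xor-if : ∀ q a b → b xor (if q then b else a) ≡ (a xor b) ∧ not q
      xor-if true  a b = trans (xor-same b) (sym (∧-zeroʳ (a xor b)))
      xor-if false a b = trans (xor-comm b a) (sym (∧-identityʳ (a xor b)))

    R : Fn n
    R x = D x ∧ (not (lookup x j) ∧ (not (lookup x k) ∧ lookup x l))

    count-R : 16 * count R ≡ 2 ^ n
    count-R = begin
      16 * count R                    ≡⟨ sixteen (count R) ⟩
      2 * (2 * (2 * (2 * count R)))   ≡⟨ cong (λ c → 2 * (2 * (2 * c))) (count-halves (unit i) D _ D-flip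
                                           λ x → cong₂ (λ a b → not a ∧ b) (lookup-⊕-unit-≢ x i≢j) (kl-fixed i≢k i≢l x)) ⟩
      2 * (2 * (2 * count (λ x → not (lookup x j) ∧ kl x)))
                                      ≡⟨ cong (λ c → 2 * (2 * c)) (count-halves (unit j) _ kl (flips j) (kl-fixed j≢k j≢l)) ⟩
      2 * (2 * count kl)              ≡⟨ cong (2 *_) (count-halves (unit k) _ (λ x → lookup x l) (flips k)
                                           λ x → lookup-⊕-unit-≢ x k≢l) ⟩
      2 * count (λ x → lookup x l)    ≡⟨ count-balanced (unit l) _ (λ x → lookup-⊕-unit x l) ⟩
      2 ^ n                           ∎
      where
      open ≡-Reasoning
      sixteen : ∀ c → 16 * c ≡ 2 * (2 * (2 * (2 * c)))
      sixteen = solve-∀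
      kl : Fn n
      kl x = not (lookup x k) ∧ lookup x l
      kl-fixed : ∀ {p} → p ≢ k → p ≢ l → ∀ x → kl (x ⊕ unit p) ≡ kl x
      kl-fixed p≢k p≢l x = cong₂ (λ a b → not a ∧ b) (lookup-⊕-unit-≢ x p≢k) (lookup-⊕-unit-≢ x p≢l)
      flips : ∀ p x → not (lookup (x ⊕ unit p) p) ≡ not (not (lookup x p))
      flips p x = cong not (lookup-⊕-unit x p)

    Q-unit : ∀ {p} → p ≢ l → Q (unit p) ≡ false
    Q-unit {p} p≢l = cong₂ _xor_ unit-j∧k (lookup-unit-≢ p≢l)
      where
      unit-j∧k : lookup (unit p) j ∧ lookup (unit p) k ≡ false
      unit-j∧k with p ≟ᶠ j
      ... | yes refl = trans (cong (lookup (unit p) j ∧_) (lookup-unit-≢ j≢k)) (∧-zeroʳ _)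
      ... | no  p≢j  = cong (_∧ lookup (unit p) k) (lookup-unit-≢ p≢j)

    Q-witness : ∀ (e : 𝔽₂ⁿ n) p → lookup e p ≡ true → Σ[ w ∈ 𝔽₂ⁿ n ] Had e w ≡ true × Q w ≡ false
    Q-witness e p eₚ with p ≟ᶠ l
    ... | no p≢l = unit p , trans (Had-unit e p) eₚ , Q-unit p≢l
    ... | yes refl with lookup e j in eⱼ | lookup e k in eₖ
    ...   | true  | _    = unit j , trans (Had-unit e j) eⱼ , Q-unit j≢l
    ...   | false | true = unit k , trans (Had-unit e k) eₖ , Q-unit k≢l
    ...   | false | false = triple , Had-triple , Q-triple
      where
      triple : 𝔽₂ⁿ n
      triple = (unit j ⊕ unit k) ⊕ unit l
      Had-triple : Had e triple ≡ true
      Had-triple rewrite Had-⊕-unit e (unit j ⊕ unit k) l | Had-⊕-unit e (unit j) k | Had-unit e j | eⱼ | eₖ | eₚ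
        = refl
      triple-j : lookup triple j ≡ true
      triple-j = trans (lookup-⊕-unit-≢ (unit j ⊕ unit k) (j≢l ∘ sym))
                       (trans (lookup-⊕-unit-≢ (unit j) (j≢k ∘ sym)) (lookup-unit j))
      triple-k : lookup triple k ≡ true
      triple-k = trans (lookup-⊕-unit-≢ (unit j ⊕ unit k) (k≢l ∘ sym))
                       (trans (lookup-⊕-unit (unit j) k) (cong not (lookup-unit-≢ j≢k)))
      triple-l : lookup triple l ≡ true
      triple-l = trans (lookup-⊕-unit (unit j ⊕ unit k) l)
                       (trans (cong not (lookup-⊕-unit-≢ (unit j) k≢l)) (cong not (lookup-unit-≢ j≢l)))
      Q-triple : Q triple ≡ false
      Q-triple rewrite triple-j | triple-k | triple-l = refl

    toKer : 𝔽₂ⁿ n → 𝔽₂ⁿ n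
    toKer w = if D w then w ⊕ unit i else w

    Had-toKer : ∀ a w → Had a (toKer w) ≡ Had a w xor (D w ∧ lookup a i)
    Had-toKer a w with D w
    ... | true  = Had-⊕-unit a w i
    ... | false = sym (xor-identityʳ (Had a w))

    D-toKer : ∀ w → D (toKer w) ≡ false
    D-toKer w rewrite Had-toKer (α ⊕ β) w | dᵢ | ∧-identityʳ (D w) = xor-same (D w)

    Q-toKer : ∀ w → Q (toKer w) ≡ Q w
    Q-toKer w with D w
    ... | true  = Q-invariant w
    ... | false = refl

    toKer-witness : ∀ c e → (∃ λ p → lookup e p ≡ true) → (∀ w → Had c (toKer w) ≡ Had e w) →
                        Σ[ u ∈ 𝔽₂ⁿ n ] Had c u ≡ true × D u ≡ false × Q u ≡ false
    toKer-witness c e (p , eₚ) Had-c-toKer with Q-witness e p eₚ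
    ... | w , Had-e-w , Q-w = toKer w , trans (Had-c-toKer w) Had-e-w , D-toKer w , trans (Q-toKer w) Q-w

    witness : ∀ γ → γ ≢ α → γ ≢ β → Σ[ u ∈ 𝔽₂ⁿ n ] Had (α ⊕ γ) u ≡ true × D u ≡ false × Q u ≡ false
    witness γ γ≢α γ≢β with lookup (α ⊕ γ) i in eᵢ
    ... | false = toKer-witness (α ⊕ γ) (α ⊕ γ) (≢⇒lookup-⊕ (γ≢α ∘ sym)) Had-toKer-α⊕γ
      where
      Had-toKer-α⊕γ : ∀ w → Had (α ⊕ γ) (toKer w) ≡ Had (α ⊕ γ) w
      Had-toKer-α⊕γ w rewrite Had-toKer (α ⊕ γ) w | eᵢ | ∧-zeroʳ (D w) = xor-identityʳ _
    ... | true = toKer-witness (α ⊕ γ) (γ ⊕ β) (≢⇒lookup-⊕ γ≢β) Had-toKer-α⊕γ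
      where
      Had-toKer-α⊕γ : ∀ w → Had (α ⊕ γ) (toKer w) ≡ Had (γ ⊕ β) w
      Had-toKer-α⊕γ w
        rewrite Had-toKer (α ⊕ γ) w | eᵢ | ∧-identityʳ (D w) | Had-⊕ˡ α γ w | Had-⊕ˡ α β w | Had-⊕ˡ γ β w
        = xor-cancel-common (Had α w) (Had γ w) (Had β w)

    dist-mid-Had : ∀ γ → dist mid (Had γ) ≡ dist (Had (α ⊕ γ)) DQ
    dist-mid-Had γ = ∑-cong λ x → cong 𝟙 (begin
      mid x xor Had γ x                                        ≡⟨ if-xor (Q x) (Had α x) (Had β x) (Had γ x) ⟩
      (Had α x xor Had γ x) xor ((Had α x xor Had β x) ∧ Q x)
        ≡⟨ cong₂ (λ a b → a xor (b ∧ Q x)) (Had-⊕ˡ α γ x) (Had-⊕ˡ α β x) ⟨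
      Had (α ⊕ γ) x xor DQ x                                   ∎)
      where
      open ≡-Reasoning
      if-xor : ∀ q a b c → (if q then b else a) xor c ≡ (a xor c) xor ((a xor b) ∧ q)
      if-xor true  a b c = trans (xor-comm b c)
                                 (trans (sym (xor-cancel-common a c b)) (cong ((a xor c) xor_) (sym (∧-identityʳ _))))
      if-xor false a b c = trans (sym (xor-identityʳ (a xor c))) (cong ((a xor c) xor_) (sym (∧-zeroʳ _)))

    module Translate (e : 𝔽₂ⁿ n) {u : 𝔽₂ⁿ n} (e-u : Had e u ≡ true) (D-u : D u ≡ false) (Q-u : Q u ≡ false) where

      E : Fn n
      E = Had e

      DQ′ : Fn n
      DQ′ x = DQ (x ⊕ u)

      common : ℕ
      common = count (λ x → DQ x ∧ DQ′ x)

      dist-notE-DQ′ : count (λ x → not (E x) xor DQ′ x) ≡ dist E DQ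
      dist-notE-DQ′ = trans (∑-cong λ x → cong (λ b → 𝟙 (b xor DQ′ x)) (sym E-flip))
                            (∑-shift u (λ x → 𝟙 (E x xor DQ x)))
        where
        E-flip : ∀ {x} → E (x ⊕ u) ≡ not (E x)
        E-flip {x} = trans (Had-⊕ʳ e x u) (trans (cong (E x xor_) e-u) (xor-comm (E x) true))

      -- Where DQ and DQ′ agree, one of E and not ∘ E disagrees with them.
      covering : 2 ^ n + (common + common) ≤ (dist E DQ + dist E DQ) + (count DQ + count DQ)
      covering = begin
        2 ^ n + (common + common)
          ≡⟨ cong₂ _+_ (trans (∑-const n 1) (ℕ.*-identityʳ (2 ^ n))) (∑-+ {n} 𝟙DQ∧DQ′ 𝟙DQ∧DQ′) ⟨
        ∑ n (λ _ → 1) + ∑ n (λ x → 𝟙DQ∧DQ′ x + 𝟙DQ∧DQ′ x)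
          ≡⟨ ∑-+ {n} (λ _ → 1) _ ⟨
        ∑ n (λ x → 1 + (𝟙DQ∧DQ′ x + 𝟙DQ∧DQ′ x))
          ≤⟨ ∑-mono-≤ (λ x → 𝟙-covering (E x) (DQ x) (DQ′ x)) ⟩
        ∑ n (λ x → (𝟙 (E x xor DQ x) + 𝟙 (not (E x) xor DQ′ x)) + (𝟙 (DQ x) + 𝟙 (DQ′ x)))
          ≡⟨ trans (∑-+ {n} _ _) (cong₂ _+_ (∑-+ {n} _ _) (∑-+ {n} _ _)) ⟩
        (dist E DQ + count (λ x → not (E x) xor DQ′ x)) + (count DQ + count DQ′)
          ≡⟨ cong₂ _+_ (cong (dist E DQ +_) dist-notE-DQ′) (cong (count DQ +_) (∑-shift u (𝟙 ∘ DQ))) ⟩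
        (dist E DQ + dist E DQ) + (count DQ + count DQ) ∎
        where
        open ℕ.≤-Reasoning
        𝟙DQ∧DQ′ : 𝔽₂ⁿ n → ℕ
        𝟙DQ∧DQ′ x = 𝟙 (DQ x ∧ DQ′ x)
        𝟙-covering : ∀ e a b → 1 + (𝟙 (a ∧ b) + 𝟙 (a ∧ b)) ≤ (𝟙 (e xor a) + 𝟙 (not e xor b)) + (𝟙 a + 𝟙 b)
        𝟙-covering true  true  true  = ℕ.≤-refl
        𝟙-covering false true  true  = ℕ.≤-refl
        𝟙-covering true  true  false = s≤s z≤n
        𝟙-covering false true  false = s≤s z≤n
        𝟙-covering true  false true  = s≤s z≤n
        𝟙-covering false false true  = s≤s z≤n
        𝟙-covering true  false false = ℕ.≤-refl
        𝟙-covering false false false = ℕ.≤-refl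

      DQ′-expand : ∀ x → DQ′ x ≡ D x ∧ (((lookup x j xor lookup u j) ∧ (lookup x k xor lookup u k))
                                         xor (lookup x l xor lookup u l))
      DQ′-expand x
        rewrite Had-⊕ʳ (α ⊕ β) x u | D-u | xor-identityʳ (D x) | lookup-⊕ x u j | lookup-⊕ x u k | lookup-⊕ x u l
        = refl

      -- On R we have x_j = x_k = 0 and x_l = 1, so Q x = 1, and Q (x ⊕ u) = not (Q u) = 1.
      count-R≤common : count R ≤ common
      count-R≤common = count-mono λ x Rx →
        trans (cong (DQ x ∧_) (DQ′-expand x)) (R⇒ (D x) (lookup x j) (lookup x k) (lookup x l) Rx)
        where
        R⇒ : ∀ d a b c → d ∧ (not a ∧ (not b ∧ c)) ≡ true →
             (d ∧ ((a ∧ b) xor c)) ∧ (d ∧ (((a xor lookup u j) ∧ (b xor lookup u k)) xor (c xor lookup u l))) ≡ true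
        R⇒ false _     _     _     ()
        R⇒ true  true  _     _     ()
        R⇒ true  false true  _     ()
        R⇒ true  false false false ()
        R⇒ true  false false true  _ = trans (sym (not-distribʳ-xor (lookup u j ∧ lookup u k) (lookup u l))) (cong not Q-u)

    mid-far : ∀ γ → γ ≢ α → γ ≢ β → 5 * 2 ^ n ≤ 16 * dist mid (Had γ)
    mid-far γ γ≢α γ≢β with witness γ γ≢α γ≢β
    ... | u , e-u , D-u , Q-u = subst (λ G → 5 * 2 ^ n ≤ 16 * G) (sym (dist-mid-Had γ))
      (far-arith {G = dist E DQ} {c = count DQ} {s = common} covering count-DQ
        (subst (_≤ 16 * common) count-R (ℕ.*-monoʳ-≤ 16 count-R≤common)))
      where open Translate (α ⊕ γ) e-u D-u Q-u

    open Walk (Had α) (Had β)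

    Q-points : List (𝔽₂ⁿ n)
    Q-points = filter (T? ∘ Q) (allVecs n)

    order : List (𝔽₂ⁿ n)
    order = Q-points ++ filter (T? ∘ not ∘ Q) (allVecs n)

    ∈-order : ∀ x → x ∈ order
    ∈-order x with Q x in Qx
    ... | true  = ∈-++⁺ˡ (∈-filter⁺ (T? ∘ Q) (∈-allVecs x) (subst T (sym Qx) _))
    ... | false = ∈-++⁺ʳ Q-points (∈-filter⁺ (T? ∘ not ∘ Q) (∈-allVecs x) (subst (T ∘ not) (sym Qx) _))

    path : ReconfSeq (Had α) (Had β)
    path = walk order ∈-order

    α≢β : α ≢ β
    α≢β refl = contradiction (trans (sym dᵢ) (trans (lookup-⊕ α α i) (xor-same (lookup α i)))) λ ()

    near : ∀ t → 2 * (dist (flipOn (take t order)) (Had α) + dist (flipOn (take t order)) (Had β)) ≡ 2 ^ n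
    near t = begin
      2 * (dist f (Had α) + dist f (Had β))   ≡⟨ cong (λ d → 2 * (d + dist f (Had β))) (dist-sym f (Had α)) ⟩
      2 * (dist (Had α) f + dist f (Had β))   ≡⟨ cong (2 *_) (dist-between (flipOn-between-ends (take t order))) ⟩
      2 * dist (Had α) (Had β)                ≡⟨ dist-Had α≢β ⟩
      2 ^ n                                   ∎
      where
      open ≡-Reasoning
      f : Fn n
      f = flipOn (take t order)

    between-codeword-mid-far : ∀ {c f} γ → γ ≢ α → γ ≢ β → c ≢ γ →
                               4 * dist (Had c) mid ≡ 2 ^ n → Between (Had c) f mid →
                               9 * 2 ^ n ≤ 32 * dist f (Had γ)
    between-codeword-mid-far {c} {f} γ γ≢α γ≢β c≢γ 4·dist≡ between =
      between-arith {X = dist f (Had γ)} {dist (Had c) (Had γ)} {dist mid (Had γ)} {dist (Had c) mid}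
        (between-lower-bound (Had γ) between) (dist-Had c≢γ) (mid-far γ γ≢α γ≢β) 4·dist≡

    far : ∀ t γ → γ ≢ α → γ ≢ β → 9 * 2 ^ n ≤ 32 * dist (flipOn (take t order)) (Had γ)
    far t γ γ≢α γ≢β with take-++-⊆ Q-points (filter (T? ∘ not ∘ Q) (allVecs n)) t
    ... | inj₁ ⊆Q-points = between-codeword-mid-far γ γ≢α γ≢β (γ≢α ∘ sym) dist-α-mid
                             (between-respʳ (flipOn-filter Q) (flipOn-between-source ⊆Q-points))
    ... | inj₂ Q-points⊆ = between-codeword-mid-far γ γ≢α γ≢β (γ≢β ∘ sym) dist-β-mid
                             (between-respʳ (flipOn-filter Q) (between-sym (flipOn-between-target Q-points⊆)))

  module _ {n : ℕ} where

    instance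
      2^n≢0 : NonZero (2 ^ n)
      2^n≢0 = ℕ.m^n≢0 2 n

    Δ-near : ∀ (f g h : Fn n) → 2 * (dist f g + dist f h) ≡ 2 ^ n → (Δ f g ⊓ Δ f h) ≤ℚ ℤ.+ 1 / 4
    Δ-near f g h near = subst₂ (λ a b → ((ℤ.+ a / 2 ^ n) ⊓ (ℤ.+ b / 2 ^ n)) ≤ℚ ℤ.+ 1 / 4)
      (sym (disagree≡dist f g)) (sym (disagree≡dist f h)) (ratio-near (dist f g) (dist f h) (2 ^ n) near)

    Δ-far : ∀ (f g : Fn n) → 9 * 2 ^ n ≤ 32 * dist f g → (ℤ.+ 1 / 4) +ℚ (ℤ.+ 1 / 400) <ℚ Δ f g
    Δ-far f g far = subst (λ a → (ℤ.+ 1 / 4) +ℚ (ℤ.+ 1 / 400) <ℚ ℤ.+ a / 2 ^ n)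
      (sym (disagree≡dist f g)) (ratio-far (dist f g) (2 ^ n) far)

-- Imported only now: the statement's ℚ operators _+_ and _<_ would clash with those of ℕ above.
open Construction using (≢⇒lookup-⊕; other-coordinates; module Path; Δ-near; Δ-far)
open import Data.Nat using (ℕ; suc; _≤_)
open import Data.Nat.Properties using (≤-trans; ≤ᵇ⇒≤)
open import Data.Rational using (ℚ; _/_; _<_; _+_; _⊓_) renaming (_≤_ to _≤ℚ_)
open import Data.Fin using (Fin; toℕ)
open import Data.Integer using (+_)
open import Data.Product using (Σ; _×_; _,_; proj₁; proj₂)
open import Relation.Binary.PropositionalEquality using (_≢_)

lemma3p2 : (n : ℕ) → 9 ≤ n → (α β : 𝔽₂ⁿ n) → α ≢ β →
  Σ (ReconfSeq (Had α) (Had β)) λ Π →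
    (i : Fin (suc (ReconfSeq.T Π))) →
      let f = ReconfSeq.seq Π i in
      ((Δ f (Had α) ⊓ Δ f (Had β)) ≤ℚ (+ 1 / 4))
      × ((γ : 𝔽₂ⁿ n) → γ ≢ α → γ ≢ β → ((+ 1 / 4) + (+ 1 / 400)) < Δ f (Had γ))
lemma3p2 n 9≤n α β α≢β = path , λ t →
    Δ-near (seq t) (Had α) (Had β) (near (toℕ t))
  , λ γ γ≢α γ≢β → Δ-far (seq t) (Had γ) (far (toℕ t) γ γ≢α γ≢β)
  where
  i : Fin n
  i = proj₁ (≢⇒lookup-⊕ α≢β)
  open Path α β (other-coordinates (≤-trans (≤ᵇ⇒≤ 4 9 _) 9≤n) i) (proj₂ (≢⇒lookup-⊕ α≢β))
  open ReconfSeq path using (seq)
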